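{- Let $M$ be a unital commutative lattice-ordered monoid. Then $\Gamma(M)=\{x\in M\mid 0\le x\le1\}$, equipped with $\vee,\wedge,0,1$ restricted from $M$ and with $x\oplus y=(x+y)\wedge1$ and $x\odot y=(x+y+(-1))\vee0$, is an MV-monoidal algebra.
   Context: A unital commutative lattice-ordered monoid is an algebra $\langle M;+,\vee,\wedge,0,1,-1\rangle$ (arities $2,2,2,0,0,0$) such that $\langle M;\vee,\wedge\rangle$ is a distributive lattice, $\langle M;+,0\rangle$ is a commutative monoid, $+$ distributes over $\vee$ and $\wedge$, $-1+1=0$, $0\le1$, and for every $x$ there is $n\in\mathbb{N}$ with $(-1)+\dots+(-1)\le x\le1+\dots+1$ ($n$ summands). An MV-monoidal algebra is an algebra $\langle A;\oplus,\odot,\vee,\wedge,0,1\rangle$ satisfying: $\langle A;\vee,\wedge\rangle$ distributive lattice; $\langle A;\oplus,0\rangle$, $\langle A;\odot,1\rangle$ commutative monoids; $\oplus$ and $\odot$ both distribute over both $\vee$ and $\wedge$; $(x\oplus y)\odot((x\odot y)\oplus z)=(x\odot(y\oplus z))\oplus(y\odot z)$; $(x\odot y)\oplus((x\oplus y)\odot z)=(x\oplus(y\odot z))\odot(y\oplus z)$; $(x\odot y)\oplus z=((x\oplus y)\odot((x\odot y)\oplus z))\vee z$; $(x\oplus y)\odot z=((x\odot y)\oplus((x\oplus y)\odot z))\wedge z$. -}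

module Defs where

open import Level using (0ℓ)
open import Data.Nat using (ℕ; zero; suc)
open import Data.Product using (Σ; ∃; _×_; _,_; proj₁)
open import Relation.Binary.PropositionalEquality using (_≡_)
open import Algebra.Core using (Op₂)
open import Algebra.Definitions using (_DistributesOver_)
open import Algebra.Structures using (IsCommutativeMonoid)
open import Algebra.Lattice.Structures using (IsDistributiveLattice)

LatLeq : {A : Set} → Op₂ A → A → A → Set
LatLeq _∧_ x y = x ∧ y ≡ x

rep : {A : Set} → Op₂ A → A → ℕ → A → A
rep _+_ e zero a = e
rep _+_ e (suc n) a = a + rep _+_ e n a

record UnitalCLOMonoid : Set₁ where
  infixl 6 _+_
  infixr 7 _∧_
  infixr 6 _∨_
  field
    Carrier : Set
    _+_ _∨_ _∧_ : Op₂ Carrier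
    𝟘 𝟙 -𝟙 : Carrier

    isDistributiveLattice : IsDistributiveLattice {A = Carrier} _≡_ _∨_ _∧_
    isCommutativeMonoid   : IsCommutativeMonoid {A = Carrier} _≡_ _+_ 𝟘
    +-distrib-∨ : _DistributesOver_ _≡_ _+_ _∨_
    +-distrib-∧ : _DistributesOver_ _≡_ _+_ _∧_
    -𝟙+𝟙        : -𝟙 + 𝟙 ≡ 𝟘
    𝟘≤𝟙         : LatLeq _∧_ 𝟘 𝟙
    unit        : ∀ x → ∃ λ n → LatLeq _∧_ (rep _+_ 𝟘 n -𝟙) x × LatLeq _∧_ x (rep _+_ 𝟘 n 𝟙)

  _≤_ : Carrier → Carrier → Set
  _≤_ = LatLeq _∧_

record IsMVMonoidal {A : Set} (_≈_ : A → A → Set)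
                    (_⊕_ _⊙_ _∨_ _∧_ : Op₂ A) (𝟘 𝟙 : A) : Set where
  field
    isDistributiveLattice : IsDistributiveLattice _≈_ _∨_ _∧_
    ⊕-isCommutativeMonoid : IsCommutativeMonoid _≈_ _⊕_ 𝟘
    ⊙-isCommutativeMonoid : IsCommutativeMonoid _≈_ _⊙_ 𝟙
    ⊕-distrib-∨ : _DistributesOver_ _≈_ _⊕_ _∨_
    ⊕-distrib-∧ : _DistributesOver_ _≈_ _⊕_ _∧_
    ⊙-distrib-∨ : _DistributesOver_ _≈_ _⊙_ _∨_
    ⊙-distrib-∧ : _DistributesOver_ _≈_ _⊙_ _∧_
    ax1 : ∀ x y z → ((x ⊕ y) ⊙ ((x ⊙ y) ⊕ z)) ≈ ((x ⊙ (y ⊕ z)) ⊕ (y ⊙ z))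
    ax2 : ∀ x y z → ((x ⊙ y) ⊕ ((x ⊕ y) ⊙ z)) ≈ ((x ⊕ (y ⊙ z)) ⊙ (y ⊕ z))
    ax3 : ∀ x y z → ((x ⊙ y) ⊕ z) ≈ (((x ⊕ y) ⊙ ((x ⊙ y) ⊕ z)) ∨ z)
    ax4 : ∀ x y z → ((x ⊕ y) ⊙ z) ≈ (((x ⊙ y) ⊕ ((x ⊕ y) ⊙ z)) ∧ z)

module _ (M : UnitalCLOMonoid) where
  open UnitalCLOMonoid M

  Γ : Set
  Γ = Σ Carrier (λ x → 𝟘 ≤ x × x ≤ 𝟙)

  _≈Γ_ : Γ → Γ → Set
  a ≈Γ b = proj₁ a ≡ proj₁ b

module Submission where

-- Everything rests on the decomposition a = (a ∧ 1) + ((a - 1) ∨ 0), valid as soon as 1 is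
-- invertible, which gives (x ⊕ y) + (x ⊙ y) = x + y.  Since + distributes over ∨ and ∧, both
-- sides of ax1 and of ax2 then reduce to the clamp of x + y + z - 1 into [0, 1], and ax3, ax4
-- say that (x ⊙ y) ⊕ z and (x ⊕ y) ⊙ z are this clamp joined, respectively met, with z.

open import Level using (0ℓ)
open import Data.Product using (Σ; _×_; _,_; proj₁; proj₂)
open import Function using (id)
open import Relation.Binary.PropositionalEquality
  using (_≡_; refl; sym; trans; cong; cong₂; subst; isEquivalence; module ≡-Reasoning)
import Relation.Binary.Construct.On as On
import Relation.Binary.Lattice.Bundles as OrderLattice
import Relation.Binary.Lattice.Properties.JoinSemilattice as JoinSemilatticeProperties
import Relation.Binary.Reasoning.PartialOrder as ≤-Reasoning
open import Algebra.Core using (Op₂)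
open import Algebra.Definitions using (_DistributesOver_; _DistributesOverˡ_; _DistributesOverʳ_; Commutative)
open import Algebra.Bundles using (CommutativeSemigroup; CommutativeMonoid)
open import Algebra.Structures using (IsCommutativeBand; IsCommutativeMonoid)
open import Algebra.Structures.Biased using (isCommutativeMonoidˡ)
open import Algebra.Consequences.Propositional using (comm∧distrˡ⇒distrʳ)
import Algebra.Properties.CommutativeSemigroup as CommutativeSemigroupProperties
open import Algebra.Lattice.Bundles using (Semilattice; DistributiveLattice)
open import Algebra.Lattice.Structures using (IsDistributiveLattice)
import Algebra.Lattice.Properties.Lattice as LatticeProperties
open import Algebra.Lattice.Morphism.Structures using (IsLatticeMonomorphism)
import Algebra.Lattice.Morphism.LatticeMonomorphism as LatticeMonomorphism
open import Defs

module _ {c ℓ} (S : Semilattice c ℓ) where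
  open Semilattice S using (_≈_; _∙_; ∙-congˡ; idem; isSemilattice)
    renaming (sym to ≈-sym; trans to ≈-trans)

  ∙-distribʳ-∙ : _DistributesOverʳ_ _≈_ _∙_ _∙_
  ∙-distribʳ-∙ x y z = ≈-trans (∙-congˡ (≈-sym (idem x))) (semimedialʳ x y z)
    where
    commutativeSemigroup : CommutativeSemigroup c ℓ
    commutativeSemigroup = record
      { isCommutativeSemigroup = IsCommutativeBand.isCommutativeSemigroup isSemilattice }
    open CommutativeSemigroupProperties commutativeSemigroup using (semimedialʳ)

module ΓConstruction (M : UnitalCLOMonoid) where
  open UnitalCLOMonoid M hiding (_≤_; 𝟘≤𝟙)

  distributiveLattice : DistributiveLattice 0ℓ 0ℓ
  distributiveLattice = record { isDistributiveLattice = isDistributiveLattice }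

  open DistributiveLattice distributiveLattice
    using (lattice; ∨-comm; ∨-assoc; ∧-comm; ∧-assoc; ∨-distribʳ-∧; ∧-distribʳ-∨)
  open LatticeProperties lattice using (∨-∧-orderTheoreticLattice; ∧-semilattice; ∨-semilattice)

  -- The standard library orders a lattice by x ≈ x ∧ y, whereas LatLeq (hence Γ) uses x ∧ y ≡ x.
  open OrderLattice.Lattice ∨-∧-orderTheoreticLattice
    using (_≤_; poset; joinSemilattice; x≤x∨y; y≤x∨y; ∨-least; x∧y≤x; x∧y≤y; ∧-greatest)
    renaming (refl to ≤-refl; trans to ≤-trans; antisym to ≤-antisym)
  open JoinSemilatticeProperties joinSemilattice using (x≤y⇒x∨y≈y)

  𝟘≤𝟙 : 𝟘 ≤ 𝟙
  𝟘≤𝟙 = sym (UnitalCLOMonoid.𝟘≤𝟙 M)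

  +-commutativeMonoid : CommutativeMonoid 0ℓ 0ℓ
  +-commutativeMonoid = record { isCommutativeMonoid = isCommutativeMonoid }

  open CommutativeMonoid +-commutativeMonoid
    using (identityˡ; identityʳ) renaming (assoc to +-assoc; comm to +-comm)
  open CommutativeSemigroupProperties (CommutativeMonoid.commutativeSemigroup +-commutativeMonoid)
    using (xy∙z≈xz∙y; xy∙z≈yz∙x)

  +-distribˡ-∧ : _DistributesOverˡ_ _≡_ _+_ _∧_
  +-distribˡ-∧ = proj₁ +-distrib-∧

  +-distribʳ-∧ : _DistributesOverʳ_ _≡_ _+_ _∧_
  +-distribʳ-∧ = proj₂ +-distrib-∧

  +-distribˡ-∨ : _DistributesOverˡ_ _≡_ _+_ _∨_
  +-distribˡ-∨ = proj₁ +-distrib-∨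

  +-distribʳ-∨ : _DistributesOverʳ_ _≡_ _+_ _∨_
  +-distribʳ-∨ = proj₂ +-distrib-∨

  +-monoʳ-≤ : ∀ z {x y} → x ≤ y → z + x ≤ z + y
  +-monoʳ-≤ z {x} {y} x≤y = trans (cong (z +_) x≤y) (+-distribˡ-∧ z x y)

  +-monoˡ-≤ : ∀ z {x y} → x ≤ y → x + z ≤ y + z
  +-monoˡ-≤ z {x} {y} x≤y = trans (cong (_+ z) x≤y) (+-distribʳ-∧ z x y)

  +-mono-≤ : ∀ {x y u v} → x ≤ y → u ≤ v → x + u ≤ y + v
  +-mono-≤ {y = y} {u} x≤y u≤v = ≤-trans (+-monoˡ-≤ u x≤y) (+-monoʳ-≤ y u≤v)

  𝟙+-𝟙≡𝟘 : 𝟙 + -𝟙 ≡ 𝟘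
  𝟙+-𝟙≡𝟘 = trans (+-comm 𝟙 -𝟙) -𝟙+𝟙

  x+𝟙+-𝟙≡x : ∀ x → x + 𝟙 + -𝟙 ≡ x
  x+𝟙+-𝟙≡x x = trans (+-assoc x 𝟙 -𝟙) (trans (cong (x +_) 𝟙+-𝟙≡𝟘) (identityʳ x))

  𝟙+[x+-𝟙]≡x : ∀ x → 𝟙 + (x + -𝟙) ≡ x
  𝟙+[x+-𝟙]≡x x = begin
    𝟙 + (x + -𝟙)  ≡⟨ +-comm 𝟙 (x + -𝟙) ⟩
    x + -𝟙 + 𝟙    ≡⟨ +-assoc x -𝟙 𝟙 ⟩
    x + (-𝟙 + 𝟙)  ≡⟨ cong (x +_) -𝟙+𝟙 ⟩
    x + 𝟘         ≡⟨ identityʳ x ⟩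
    x             ∎
    where open ≡-Reasoning

  x≤x+y : ∀ x {y} → 𝟘 ≤ y → x ≤ x + y
  x≤x+y x {y} 𝟘≤y = subst (_≤ x + y) (identityʳ x) (+-monoʳ-≤ x 𝟘≤y)

  x+y+-𝟙≤x : ∀ x {y} → y ≤ 𝟙 → x + y + -𝟙 ≤ x
  x+y+-𝟙≤x x {y} y≤𝟙 = begin
    x + y + -𝟙    ≡⟨ +-assoc x y -𝟙 ⟩
    x + (y + -𝟙)  ≤⟨ +-monoʳ-≤ x (+-monoˡ-≤ -𝟙 y≤𝟙) ⟩
    x + (𝟙 + -𝟙)  ≡⟨ cong (x +_) 𝟙+-𝟙≡𝟘 ⟩
    x + 𝟘         ≡⟨ identityʳ x ⟩
    x             ∎
    where open ≤-Reasoning poset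

  infix 8 _⊕_ _⊙_

  _⊕_ : Op₂ Carrier
  x ⊕ y = (x + y) ∧ 𝟙

  _⊙_ : Op₂ Carrier
  x ⊙ y = (x + y + -𝟙) ∨ 𝟘

  x∧𝟙+[x+-𝟙]∨𝟘≡x : ∀ x → x ∧ 𝟙 + ((x + -𝟙) ∨ 𝟘) ≡ x
  x∧𝟙+[x+-𝟙]∨𝟘≡x x = ≤-antisym upper lower
    where
    open ≤-Reasoning poset
    v : Carrier
    v = (x + -𝟙) ∨ 𝟘

    upper : x ∧ 𝟙 + v ≤ x
    upper = begin
      x ∧ 𝟙 + v                              ≡⟨ +-distribˡ-∨ (x ∧ 𝟙) (x + -𝟙) 𝟘 ⟩
      (x ∧ 𝟙 + (x + -𝟙)) ∨ (x ∧ 𝟙 + 𝟘)       ≤⟨ ∨-least x∧𝟙+[x+-𝟙]≤x x∧𝟙+𝟘≤x ⟩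
      x                                      ∎
      where
      x∧𝟙+[x+-𝟙]≤x : x ∧ 𝟙 + (x + -𝟙) ≤ x
      x∧𝟙+[x+-𝟙]≤x = begin
        x ∧ 𝟙 + (x + -𝟙)  ≤⟨ +-monoˡ-≤ (x + -𝟙) (x∧y≤y x 𝟙) ⟩
        𝟙 + (x + -𝟙)      ≡⟨ 𝟙+[x+-𝟙]≡x x ⟩
        x                 ∎
      x∧𝟙+𝟘≤x : x ∧ 𝟙 + 𝟘 ≤ x
      x∧𝟙+𝟘≤x = begin
        x ∧ 𝟙 + 𝟘  ≡⟨ identityʳ (x ∧ 𝟙) ⟩
        x ∧ 𝟙      ≤⟨ x∧y≤x x 𝟙 ⟩
        x          ∎

    lower : x ≤ x ∧ 𝟙 + v
    lower = begin
      x                  ≤⟨ ∧-greatest (x≤x+y x (y≤x∨y (x + -𝟙) 𝟘)) x≤𝟙+v ⟩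
      (x + v) ∧ (𝟙 + v)  ≡⟨ +-distribʳ-∧ v x 𝟙 ⟨
      x ∧ 𝟙 + v          ∎
      where
      x≤𝟙+v : x ≤ 𝟙 + v
      x≤𝟙+v = begin
        x             ≡⟨ 𝟙+[x+-𝟙]≡x x ⟨
        𝟙 + (x + -𝟙)  ≤⟨ +-monoʳ-≤ 𝟙 (x≤x∨y (x + -𝟙) 𝟘) ⟩
        𝟙 + v         ∎

  x⊕y+x⊙y≡x+y : ∀ x y → x ⊕ y + x ⊙ y ≡ x + y
  x⊕y+x⊙y≡x+y x y = x∧𝟙+[x+-𝟙]∨𝟘≡x (x + y)

  ⊕-comm : Commutative _≡_ _⊕_
  ⊕-comm x y = cong (_∧ 𝟙) (+-comm x y)

  ⊙-comm : Commutative _≡_ _⊙_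
  ⊙-comm x y = cong (λ t → (t + -𝟙) ∨ 𝟘) (+-comm x y)

  [x∧𝟙]⊕y≡[x+y]∧𝟙 : ∀ x {y} → 𝟘 ≤ y → (x ∧ 𝟙) ⊕ y ≡ (x + y) ∧ 𝟙
  [x∧𝟙]⊕y≡[x+y]∧𝟙 x {y} 𝟘≤y = begin
    (x ∧ 𝟙 + y) ∧ 𝟙            ≡⟨ cong (_∧ 𝟙) (+-distribʳ-∧ y x 𝟙) ⟩
    ((x + y) ∧ (𝟙 + y)) ∧ 𝟙    ≡⟨ ∧-assoc (x + y) (𝟙 + y) 𝟙 ⟩
    (x + y) ∧ ((𝟙 + y) ∧ 𝟙)    ≡⟨ cong ((x + y) ∧_) (trans (∧-comm (𝟙 + y) 𝟙) (sym 𝟙≤𝟙+y)) ⟩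
    (x + y) ∧ 𝟙                ∎
    where
    open ≡-Reasoning
    𝟙≤𝟙+y : 𝟙 ≤ 𝟙 + y
    𝟙≤𝟙+y = x≤x+y 𝟙 𝟘≤y

  [x∨𝟘]⊙y≡[x+y+-𝟙]∨𝟘 : ∀ x {y} → y ≤ 𝟙 → (x ∨ 𝟘) ⊙ y ≡ (x + y + -𝟙) ∨ 𝟘
  [x∨𝟘]⊙y≡[x+y+-𝟙]∨𝟘 x {y} y≤𝟙 = begin
    ((x ∨ 𝟘) + y + -𝟙) ∨ 𝟘                      ≡⟨ cong (λ t → (t + -𝟙) ∨ 𝟘) (+-distribʳ-∨ y x 𝟘) ⟩
    (((x + y) ∨ (𝟘 + y)) + -𝟙) ∨ 𝟘              ≡⟨ cong (_∨ 𝟘) (+-distribʳ-∨ -𝟙 (x + y) (𝟘 + y)) ⟩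
    ((x + y + -𝟙) ∨ (𝟘 + y + -𝟙)) ∨ 𝟘           ≡⟨ ∨-assoc (x + y + -𝟙) (𝟘 + y + -𝟙) 𝟘 ⟩
    (x + y + -𝟙) ∨ ((𝟘 + y + -𝟙) ∨ 𝟘)           ≡⟨ cong ((x + y + -𝟙) ∨_) (x≤y⇒x∨y≈y (x+y+-𝟙≤x 𝟘 y≤𝟙)) ⟩
    (x + y + -𝟙) ∨ 𝟘                            ∎
    where open ≡-Reasoning

  ⊕-assoc : ∀ {x y z} → 𝟘 ≤ x → 𝟘 ≤ z → (x ⊕ y) ⊕ z ≡ x ⊕ (y ⊕ z)
  ⊕-assoc {x} {y} {z} 𝟘≤x 𝟘≤z = begin
    (x ⊕ y) ⊕ z        ≡⟨ [x∧𝟙]⊕y≡[x+y]∧𝟙 (x + y) 𝟘≤z ⟩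
    (x + y + z) ∧ 𝟙    ≡⟨ cong (_∧ 𝟙) (xy∙z≈yz∙x x y z) ⟩
    (y + z + x) ∧ 𝟙    ≡⟨ [x∧𝟙]⊕y≡[x+y]∧𝟙 (y + z) 𝟘≤x ⟨
    (y ⊕ z) ⊕ x        ≡⟨ ⊕-comm (y ⊕ z) x ⟩
    x ⊕ (y ⊕ z)        ∎
    where open ≡-Reasoning

  ⊙-assoc : ∀ {x y z} → x ≤ 𝟙 → z ≤ 𝟙 → (x ⊙ y) ⊙ z ≡ x ⊙ (y ⊙ z)
  ⊙-assoc {x} {y} {z} x≤𝟙 z≤𝟙 = begin
    (x ⊙ y) ⊙ z                ≡⟨ [x∨𝟘]⊙y≡[x+y+-𝟙]∨𝟘 (x + y + -𝟙) z≤𝟙 ⟩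
    (x + y + -𝟙 + z + -𝟙) ∨ 𝟘  ≡⟨ cong (λ t → (t + -𝟙) ∨ 𝟘) rotate ⟩
    (y + z + -𝟙 + x + -𝟙) ∨ 𝟘  ≡⟨ [x∨𝟘]⊙y≡[x+y+-𝟙]∨𝟘 (y + z + -𝟙) x≤𝟙 ⟨
    (y ⊙ z) ⊙ x                ≡⟨ ⊙-comm (y ⊙ z) x ⟩
    x ⊙ (y ⊙ z)                ∎
    where
    open ≡-Reasoning
    rotate : x + y + -𝟙 + z ≡ y + z + -𝟙 + x
    rotate = begin
      x + y + -𝟙 + z  ≡⟨ xy∙z≈xz∙y (x + y) -𝟙 z ⟩
      x + y + z + -𝟙  ≡⟨ cong (_+ -𝟙) (xy∙z≈yz∙x x y z) ⟩
      y + z + x + -𝟙  ≡⟨ xy∙z≈xz∙y (y + z) x -𝟙 ⟩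
      y + z + -𝟙 + x  ∎

  ⊕-identityˡ : ∀ {x} → x ≤ 𝟙 → 𝟘 ⊕ x ≡ x
  ⊕-identityˡ {x} x≤𝟙 = trans (cong (_∧ 𝟙) (identityˡ x)) (sym x≤𝟙)

  ⊙-identityˡ : ∀ {x} → 𝟘 ≤ x → 𝟙 ⊙ x ≡ x
  ⊙-identityˡ {x} 𝟘≤x = begin
    (𝟙 + x + -𝟙) ∨ 𝟘  ≡⟨ cong (λ t → (t + -𝟙) ∨ 𝟘) (+-comm 𝟙 x) ⟩
    (x + 𝟙 + -𝟙) ∨ 𝟘  ≡⟨ cong (_∨ 𝟘) (x+𝟙+-𝟙≡x x) ⟩
    x ∨ 𝟘             ≡⟨ ∨-comm x 𝟘 ⟩
    𝟘 ∨ x             ≡⟨ x≤y⇒x∨y≈y 𝟘≤x ⟩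
    x                 ∎
    where open ≡-Reasoning

  ⊕-distrib-∨ : _DistributesOver_ _≡_ _⊕_ _∨_
  ⊕-distrib-∨ = distribˡ , comm∧distrˡ⇒distrʳ ⊕-comm distribˡ
    where
    distribˡ : _DistributesOverˡ_ _≡_ _⊕_ _∨_
    distribˡ x y z = trans (cong (_∧ 𝟙) (+-distribˡ-∨ x y z)) (∧-distribʳ-∨ 𝟙 (x + y) (x + z))

  ⊕-distrib-∧ : _DistributesOver_ _≡_ _⊕_ _∧_
  ⊕-distrib-∧ = distribˡ , comm∧distrˡ⇒distrʳ ⊕-comm distribˡ
    where
    distribˡ : _DistributesOverˡ_ _≡_ _⊕_ _∧_
    distribˡ x y z =
      trans (cong (_∧ 𝟙) (+-distribˡ-∧ x y z)) (∙-distribʳ-∙ ∧-semilattice 𝟙 (x + y) (x + z))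

  ⊙-distrib-∨ : _DistributesOver_ _≡_ _⊙_ _∨_
  ⊙-distrib-∨ = distribˡ , comm∧distrˡ⇒distrʳ ⊙-comm distribˡ
    where
    distribˡ : _DistributesOverˡ_ _≡_ _⊙_ _∨_
    distribˡ x y z = begin
      ((x + (y ∨ z)) + -𝟙) ∨ 𝟘              ≡⟨ cong (λ t → (t + -𝟙) ∨ 𝟘) (+-distribˡ-∨ x y z) ⟩
      (((x + y) ∨ (x + z)) + -𝟙) ∨ 𝟘        ≡⟨ cong (_∨ 𝟘) (+-distribʳ-∨ -𝟙 (x + y) (x + z)) ⟩
      ((x + y + -𝟙) ∨ (x + z + -𝟙)) ∨ 𝟘     ≡⟨ ∙-distribʳ-∙ ∨-semilattice 𝟘 (x + y + -𝟙) (x + z + -𝟙) ⟩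
      (x ⊙ y) ∨ (x ⊙ z)                     ∎
      where open ≡-Reasoning

  ⊙-distrib-∧ : _DistributesOver_ _≡_ _⊙_ _∧_
  ⊙-distrib-∧ = distribˡ , comm∧distrˡ⇒distrʳ ⊙-comm distribˡ
    where
    distribˡ : _DistributesOverˡ_ _≡_ _⊙_ _∧_
    distribˡ x y z = begin
      ((x + (y ∧ z)) + -𝟙) ∨ 𝟘              ≡⟨ cong (λ t → (t + -𝟙) ∨ 𝟘) (+-distribˡ-∧ x y z) ⟩
      (((x + y) ∧ (x + z)) + -𝟙) ∨ 𝟘        ≡⟨ cong (_∨ 𝟘) (+-distribʳ-∧ -𝟙 (x + y) (x + z)) ⟩
      ((x + y + -𝟙) ∧ (x + z + -𝟙)) ∨ 𝟘     ≡⟨ ∨-distribʳ-∧ 𝟘 (x + y + -𝟙) (x + z + -𝟙) ⟩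
      (x ⊙ y) ∧ (x ⊙ z)                     ∎
      where open ≡-Reasoning

  clamp : Carrier → Carrier
  clamp x = (x ∨ 𝟘) ∧ 𝟙

  [x∧𝟙]∨𝟘≡clamp : ∀ x → (x ∧ 𝟙) ∨ 𝟘 ≡ clamp x
  [x∧𝟙]∨𝟘≡clamp x = trans (∨-distribʳ-∧ 𝟘 x 𝟙) (cong ((x ∨ 𝟘) ∧_) 𝟙∨𝟘≡𝟙)
    where
    𝟙∨𝟘≡𝟙 : 𝟙 ∨ 𝟘 ≡ 𝟙
    𝟙∨𝟘≡𝟙 = trans (∨-comm 𝟙 𝟘) (x≤y⇒x∨y≈y 𝟘≤𝟙)

  [x⊕y]⊙[[x⊙y]⊕z]≡clamp : ∀ x y {z} → z ≤ 𝟙 →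
                          (x ⊕ y) ⊙ ((x ⊙ y) ⊕ z) ≡ clamp (x + y + z + -𝟙)
  [x⊕y]⊙[[x⊙y]⊕z]≡clamp x y {z} z≤𝟙 = begin
    (u + ((v + z) ∧ 𝟙) + -𝟙) ∨ 𝟘            ≡⟨ cong (λ t → (t + -𝟙) ∨ 𝟘) (+-distribˡ-∧ u (v + z) 𝟙) ⟩
    (((u + (v + z)) ∧ (u + 𝟙)) + -𝟙) ∨ 𝟘    ≡⟨ cong (λ t → ((t ∧ (u + 𝟙)) + -𝟙) ∨ 𝟘) u+[v+z]≡s ⟩
    ((s ∧ (u + 𝟙)) + -𝟙) ∨ 𝟘                ≡⟨ cong (_∨ 𝟘) (+-distribʳ-∧ -𝟙 s (u + 𝟙)) ⟩
    ((s + -𝟙) ∧ (u + 𝟙 + -𝟙)) ∨ 𝟘           ≡⟨ cong (λ t → ((s + -𝟙) ∧ t) ∨ 𝟘) (x+𝟙+-𝟙≡x u) ⟩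
    ((s + -𝟙) ∧ (x + y) ∧ 𝟙) ∨ 𝟘            ≡⟨ cong (_∨ 𝟘) (∧-assoc (s + -𝟙) (x + y) 𝟙) ⟨
    (((s + -𝟙) ∧ (x + y)) ∧ 𝟙) ∨ 𝟘          ≡⟨ cong (λ t → (t ∧ 𝟙) ∨ 𝟘) (x+y+-𝟙≤x (x + y) z≤𝟙) ⟨
    ((s + -𝟙) ∧ 𝟙) ∨ 𝟘                      ≡⟨ [x∧𝟙]∨𝟘≡clamp (s + -𝟙) ⟩
    clamp (s + -𝟙)                          ∎
    where
    open ≡-Reasoning
    u v s : Carrier
    u = x ⊕ y
    v = x ⊙ y
    s = x + y + z
    u+[v+z]≡s : u + (v + z) ≡ s
    u+[v+z]≡s = trans (sym (+-assoc u v z)) (cong (_+ z) (x⊕y+x⊙y≡x+y x y))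

  [x⊙y]⊕[[x⊕y]⊙z]≡clamp : ∀ x y {z} → 𝟘 ≤ z →
                          (x ⊙ y) ⊕ ((x ⊕ y) ⊙ z) ≡ clamp (x + y + z + -𝟙)
  [x⊙y]⊕[[x⊕y]⊙z]≡clamp x y {z} 𝟘≤z = cong (_∧ 𝟙) (begin
    v + ((u + z + -𝟙) ∨ 𝟘)                  ≡⟨ +-distribˡ-∨ v (u + z + -𝟙) 𝟘 ⟩
    (v + (u + z + -𝟙)) ∨ (v + 𝟘)            ≡⟨ cong₂ _∨_ v+[u+z+-𝟙]≡s+-𝟙 (identityʳ v) ⟩
    (s + -𝟙) ∨ ((x + y + -𝟙) ∨ 𝟘)           ≡⟨ ∨-assoc (s + -𝟙) (x + y + -𝟙) 𝟘 ⟨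
    ((s + -𝟙) ∨ (x + y + -𝟙)) ∨ 𝟘           ≡⟨ cong (_∨ 𝟘) (trans (∨-comm (s + -𝟙) (x + y + -𝟙)) (x≤y⇒x∨y≈y x+y+-𝟙≤s+-𝟙)) ⟩
    (s + -𝟙) ∨ 𝟘                            ∎)
    where
    open ≡-Reasoning
    u v s : Carrier
    u = x ⊕ y
    v = x ⊙ y
    s = x + y + z
    v+[u+z+-𝟙]≡s+-𝟙 : v + (u + z + -𝟙) ≡ s + -𝟙
    v+[u+z+-𝟙]≡s+-𝟙 = begin
      v + (u + z + -𝟙)  ≡⟨ +-assoc v (u + z) -𝟙 ⟨
      v + (u + z) + -𝟙  ≡⟨ cong (_+ -𝟙) (+-assoc v u z) ⟨
      v + u + z + -𝟙    ≡⟨ cong (λ t → t + z + -𝟙) (trans (+-comm v u) (x⊕y+x⊙y≡x+y x y)) ⟩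
      s + -𝟙            ∎
    x+y+-𝟙≤s+-𝟙 : x + y + -𝟙 ≤ s + -𝟙
    x+y+-𝟙≤s+-𝟙 = +-monoˡ-≤ -𝟙 (x≤x+y (x + y) 𝟘≤z)

  [x⊙y]⊕z≡clamp∨z : ∀ x y {z} → 𝟘 ≤ z → z ≤ 𝟙 → (x ⊙ y) ⊕ z ≡ clamp (x + y + z + -𝟙) ∨ z
  [x⊙y]⊕z≡clamp∨z x y {z} 𝟘≤z z≤𝟙 = begin
    ((x ⊙ y) + z) ∧ 𝟙                       ≡⟨ cong (_∧ 𝟙) (+-distribʳ-∨ z (x + y + -𝟙) 𝟘) ⟩
    ((x + y + -𝟙 + z) ∨ (𝟘 + z)) ∧ 𝟙        ≡⟨ cong (_∧ 𝟙) (cong₂ _∨_ (xy∙z≈xz∙y (x + y) -𝟙 z) (identityˡ z)) ⟩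
    ((s + -𝟙) ∨ z) ∧ 𝟙                      ≡⟨ cong₂ _∧_ (cong ((s + -𝟙) ∨_) (x≤y⇒x∨y≈y 𝟘≤z)) 𝟙∨z≡𝟙 ⟨
    ((s + -𝟙) ∨ (𝟘 ∨ z)) ∧ (𝟙 ∨ z)          ≡⟨ cong (_∧ (𝟙 ∨ z)) (∨-assoc (s + -𝟙) 𝟘 z) ⟨
    (((s + -𝟙) ∨ 𝟘) ∨ z) ∧ (𝟙 ∨ z)          ≡⟨ ∨-distribʳ-∧ z ((s + -𝟙) ∨ 𝟘) 𝟙 ⟨
    clamp (s + -𝟙) ∨ z                      ∎
    where
    open ≡-Reasoning
    s : Carrier
    s = x + y + z
    𝟙∨z≡𝟙 : 𝟙 ∨ z ≡ 𝟙
    𝟙∨z≡𝟙 = trans (∨-comm 𝟙 z) (x≤y⇒x∨y≈y z≤𝟙)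

  [x⊕y]⊙z≡clamp∧z : ∀ x y {z} → 𝟘 ≤ z → z ≤ 𝟙 → (x ⊕ y) ⊙ z ≡ clamp (x + y + z + -𝟙) ∧ z
  [x⊕y]⊙z≡clamp∧z x y {z} 𝟘≤z z≤𝟙 = begin
    ((x + y) ∧ 𝟙 + z + -𝟙) ∨ 𝟘              ≡⟨ cong (λ t → (t + -𝟙) ∨ 𝟘) (+-distribʳ-∧ z (x + y) 𝟙) ⟩
    ((s ∧ (𝟙 + z)) + -𝟙) ∨ 𝟘                ≡⟨ cong (_∨ 𝟘) (+-distribʳ-∧ -𝟙 s (𝟙 + z)) ⟩
    ((s + -𝟙) ∧ (𝟙 + z + -𝟙)) ∨ 𝟘           ≡⟨ cong (λ t → ((s + -𝟙) ∧ t) ∨ 𝟘) 𝟙+z+-𝟙≡z ⟩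
    ((s + -𝟙) ∧ z) ∨ 𝟘                      ≡⟨ cong (((s + -𝟙) ∧ z) ∨_) 𝟘≤z ⟩
    ((s + -𝟙) ∧ z) ∨ (𝟘 ∧ z)                ≡⟨ ∧-distribʳ-∨ z (s + -𝟙) 𝟘 ⟨
    ((s + -𝟙) ∨ 𝟘) ∧ z                      ≡⟨ cong (((s + -𝟙) ∨ 𝟘) ∧_) (trans (∧-comm 𝟙 z) (sym z≤𝟙)) ⟨
    ((s + -𝟙) ∨ 𝟘) ∧ 𝟙 ∧ z                  ≡⟨ ∧-assoc ((s + -𝟙) ∨ 𝟘) 𝟙 z ⟨
    clamp (s + -𝟙) ∧ z                      ∎
    where
    open ≡-Reasoning
    s : Carrier
    s = x + y + z
    𝟙+z+-𝟙≡z : 𝟙 + z + -𝟙 ≡ z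
    𝟙+z+-𝟙≡z = trans (cong (_+ -𝟙) (+-comm 𝟙 z)) (x+𝟙+-𝟙≡x z)

  InUnit : Carrier → Set
  InUnit x = 𝟘 ≤ x × x ≤ 𝟙

  inUnit : (a : Γ M) → InUnit (proj₁ a)
  inUnit (_ , 𝟘≤a , a≤𝟙) = sym 𝟘≤a , sym a≤𝟙

  toΓ : ∀ {x} → InUnit x → Γ M
  toΓ {x} (𝟘≤x , x≤𝟙) = x , sym 𝟘≤x , sym x≤𝟙

  ClosedUnderOp : Op₂ Carrier → Set
  ClosedUnderOp _∙_ = ∀ {x y} → InUnit x → InUnit y → InUnit (x ∙ y)

  liftΓ : (_∙_ : Op₂ Carrier) → ClosedUnderOp _∙_ → Op₂ (Γ M)
  liftΓ _∙_ closed a b = toΓ (closed (inUnit a) (inUnit b))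

  ⊕-closed : ClosedUnderOp _⊕_
  ⊕-closed {x} {y} (𝟘≤x , _) (𝟘≤y , _) = ∧-greatest 𝟘≤x+y 𝟘≤𝟙 , x∧y≤y (x + y) 𝟙
    where
    𝟘≤x+y : 𝟘 ≤ x + y
    𝟘≤x+y = subst (_≤ x + y) (identityʳ 𝟘) (+-mono-≤ 𝟘≤x 𝟘≤y)

  ⊙-closed : ClosedUnderOp _⊙_
  ⊙-closed {x} {y} (_ , x≤𝟙) (_ , y≤𝟙) = y≤x∨y (x + y + -𝟙) 𝟘 , ∨-least x+y+-𝟙≤𝟙 𝟘≤𝟙
    where
    x+y+-𝟙≤𝟙 : x + y + -𝟙 ≤ 𝟙
    x+y+-𝟙≤𝟙 = ≤-trans (+-monoˡ-≤ -𝟙 (+-mono-≤ x≤𝟙 y≤𝟙)) (x+y+-𝟙≤x 𝟙 ≤-refl)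

  ∨-closed : ClosedUnderOp _∨_
  ∨-closed {x} {y} (𝟘≤x , x≤𝟙) (_ , y≤𝟙) = ≤-trans 𝟘≤x (x≤x∨y x y) , ∨-least x≤𝟙 y≤𝟙

  ∧-closed : ClosedUnderOp _∧_
  ∧-closed {x} {y} (𝟘≤x , x≤𝟙) (𝟘≤y , _) = ∧-greatest 𝟘≤x 𝟘≤y , ≤-trans (x∧y≤x x y) x≤𝟙

  liftΓ-distrib : ∀ {_∘_ _•_} (∘-closed : ClosedUnderOp _∘_) (•-closed : ClosedUnderOp _•_) →
                  _DistributesOver_ _≡_ _∘_ _•_ →
                  _DistributesOver_ (_≈Γ_ M) (liftΓ _∘_ ∘-closed) (liftΓ _•_ •-closed)
  liftΓ-distrib _ _ (distribˡ , distribʳ) =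
    (λ a b c → distribˡ (proj₁ a) (proj₁ b) (proj₁ c)) ,
    (λ a b c → distribʳ (proj₁ a) (proj₁ b) (proj₁ c))

  liftΓ-isCommutativeMonoid :
    ∀ {_∙_ e} (closed : ClosedUnderOp _∙_) (e∈ : InUnit e) →
    (∀ {x y z} → InUnit x → InUnit y → InUnit z → (x ∙ y) ∙ z ≡ x ∙ (y ∙ z)) →
    (∀ {x} → InUnit x → e ∙ x ≡ x) →
    Commutative _≡_ _∙_ →
    IsCommutativeMonoid (_≈Γ_ M) (liftΓ _∙_ closed) (toΓ e∈)
  liftΓ-isCommutativeMonoid {_∙_} _ _ ∙-assoc ∙-identityˡ ∙-comm = isCommutativeMonoidˡ record
    { isSemigroup = record
      { isMagma = record
        { isEquivalence = On.isEquivalence proj₁ isEquivalence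
        ; ∙-cong        = cong₂ _∙_
        }
      ; assoc = λ a b c → ∙-assoc (inUnit a) (inUnit b) (inUnit c)
      }
    ; identityˡ = λ a → ∙-identityˡ (inUnit a)
    ; comm      = λ a b → ∙-comm (proj₁ a) (proj₁ b)
    }

  _⊕Γ_ _⊙Γ_ _∨Γ_ _∧Γ_ : Op₂ (Γ M)
  _⊕Γ_ = liftΓ _⊕_ ⊕-closed
  _⊙Γ_ = liftΓ _⊙_ ⊙-closed
  _∨Γ_ = liftΓ _∨_ ∨-closed
  _∧Γ_ = liftΓ _∧_ ∧-closed

  𝟘Γ 𝟙Γ : Γ M
  𝟘Γ = toΓ (≤-refl , 𝟘≤𝟙)
  𝟙Γ = toΓ (𝟘≤𝟙 , ≤-refl)

  proj₁-isLatticeMonomorphism :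
    IsLatticeMonomorphism
      (record { Carrier = Γ M ; _≈_ = _≈Γ_ M ; _∧_ = _∧Γ_ ; _∨_ = _∨Γ_ })
      (record { Carrier = Carrier ; _≈_ = _≡_ ; _∧_ = _∧_ ; _∨_ = _∨_ })
      proj₁
  proj₁-isLatticeMonomorphism = record
    { isLatticeHomomorphism = record
      { isRelHomomorphism = record { cong = id }
      ; ∧-homo            = λ _ _ → refl
      ; ∨-homo            = λ _ _ → refl
      }
    ; injective = id
    }

  Γ-isDistributiveLattice : IsDistributiveLattice (_≈Γ_ M) _∨Γ_ _∧Γ_
  Γ-isDistributiveLattice =
    LatticeMonomorphism.isDistributiveLattice proj₁-isLatticeMonomorphism isDistributiveLattice

  Γ-isMVMonoidal : IsMVMonoidal (_≈Γ_ M) _⊕Γ_ _⊙Γ_ _∨Γ_ _∧Γ_ 𝟘Γ 𝟙Γ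
  Γ-isMVMonoidal = record
    { isDistributiveLattice = Γ-isDistributiveLattice
    ; ⊕-isCommutativeMonoid =
        liftΓ-isCommutativeMonoid ⊕-closed (≤-refl , 𝟘≤𝟙)
          (λ (𝟘≤x , _) _ (𝟘≤z , _) → ⊕-assoc 𝟘≤x 𝟘≤z) (λ (_ , x≤𝟙) → ⊕-identityˡ x≤𝟙) ⊕-comm
    ; ⊙-isCommutativeMonoid =
        liftΓ-isCommutativeMonoid ⊙-closed (𝟘≤𝟙 , ≤-refl)
          (λ (_ , x≤𝟙) _ (_ , z≤𝟙) → ⊙-assoc x≤𝟙 z≤𝟙) (λ (𝟘≤x , _) → ⊙-identityˡ 𝟘≤x) ⊙-comm
    ; ⊕-distrib-∨ = liftΓ-distrib ⊕-closed ∨-closed ⊕-distrib-∨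
    ; ⊕-distrib-∧ = liftΓ-distrib ⊕-closed ∧-closed ⊕-distrib-∧
    ; ⊙-distrib-∨ = liftΓ-distrib ⊙-closed ∨-closed ⊙-distrib-∨
    ; ⊙-distrib-∧ = liftΓ-distrib ⊙-closed ∧-closed ⊙-distrib-∧
    ; ax1 = λ a b c → ax1 (proj₁ a) (proj₁ b) (proj₁ c) (proj₁ (inUnit a)) (proj₂ (inUnit c))
    ; ax2 = λ a b c → ax2 (proj₁ a) (proj₁ b) (proj₁ c) (proj₂ (inUnit a)) (proj₁ (inUnit c))
    ; ax3 = λ a b c → ax3 (proj₁ a) (proj₁ b) (proj₁ c) (inUnit c)
    ; ax4 = λ a b c → ax4 (proj₁ a) (proj₁ b) (proj₁ c) (inUnit c)
    }
    where
    open ≡-Reasoning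

    clamp-rotate : ∀ x y z → clamp (x + y + z + -𝟙) ≡ clamp (y + z + x + -𝟙)
    clamp-rotate x y z = cong (λ t → clamp (t + -𝟙)) (xy∙z≈yz∙x x y z)

    ax1 : ∀ x y z → 𝟘 ≤ x → z ≤ 𝟙 → (x ⊕ y) ⊙ ((x ⊙ y) ⊕ z) ≡ (x ⊙ (y ⊕ z)) ⊕ (y ⊙ z)
    ax1 x y z 𝟘≤x z≤𝟙 = begin
      (x ⊕ y) ⊙ ((x ⊙ y) ⊕ z)    ≡⟨ [x⊕y]⊙[[x⊙y]⊕z]≡clamp x y z≤𝟙 ⟩
      clamp (x + y + z + -𝟙)     ≡⟨ clamp-rotate x y z ⟩
      clamp (y + z + x + -𝟙)     ≡⟨ [x⊙y]⊕[[x⊕y]⊙z]≡clamp y z 𝟘≤x ⟨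
      (y ⊙ z) ⊕ ((y ⊕ z) ⊙ x)    ≡⟨ ⊕-comm (y ⊙ z) ((y ⊕ z) ⊙ x) ⟩
      ((y ⊕ z) ⊙ x) ⊕ (y ⊙ z)    ≡⟨ cong (_⊕ (y ⊙ z)) (⊙-comm (y ⊕ z) x) ⟩
      (x ⊙ (y ⊕ z)) ⊕ (y ⊙ z)    ∎

    ax2 : ∀ x y z → x ≤ 𝟙 → 𝟘 ≤ z → (x ⊙ y) ⊕ ((x ⊕ y) ⊙ z) ≡ (x ⊕ (y ⊙ z)) ⊙ (y ⊕ z)
    ax2 x y z x≤𝟙 𝟘≤z = begin
      (x ⊙ y) ⊕ ((x ⊕ y) ⊙ z)    ≡⟨ [x⊙y]⊕[[x⊕y]⊙z]≡clamp x y 𝟘≤z ⟩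
      clamp (x + y + z + -𝟙)     ≡⟨ clamp-rotate x y z ⟩
      clamp (y + z + x + -𝟙)     ≡⟨ [x⊕y]⊙[[x⊙y]⊕z]≡clamp y z x≤𝟙 ⟨
      (y ⊕ z) ⊙ ((y ⊙ z) ⊕ x)    ≡⟨ ⊙-comm (y ⊕ z) ((y ⊙ z) ⊕ x) ⟩
      ((y ⊙ z) ⊕ x) ⊙ (y ⊕ z)    ≡⟨ cong (_⊙ (y ⊕ z)) (⊕-comm (y ⊙ z) x) ⟩
      (x ⊕ (y ⊙ z)) ⊙ (y ⊕ z)    ∎

    ax3 : ∀ x y z → InUnit z → (x ⊙ y) ⊕ z ≡ ((x ⊕ y) ⊙ ((x ⊙ y) ⊕ z)) ∨ z
    ax3 x y z (𝟘≤z , z≤𝟙) = trans ([x⊙y]⊕z≡clamp∨z x y 𝟘≤z z≤𝟙)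
                                  (cong (_∨ z) (sym ([x⊕y]⊙[[x⊙y]⊕z]≡clamp x y z≤𝟙)))

    ax4 : ∀ x y z → InUnit z → (x ⊕ y) ⊙ z ≡ ((x ⊙ y) ⊕ ((x ⊕ y) ⊙ z)) ∧ z
    ax4 x y z (𝟘≤z , z≤𝟙) = trans ([x⊕y]⊙z≡clamp∧z x y 𝟘≤z z≤𝟙)
                                  (cong (_∧ z) (sym ([x⊙y]⊕[[x⊕y]⊙z]≡clamp x y 𝟘≤z)))

proposition3p6 : (M : UnitalCLOMonoid) →
    let open UnitalCLOMonoid M in
    Σ (Op₂ (Γ M)) λ _⊕_ → Σ (Op₂ (Γ M)) λ _⊙_ →
    Σ (Op₂ (Γ M)) λ _∨Γ_ → Σ (Op₂ (Γ M)) λ _∧Γ_ →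
    Σ (Γ M) λ 𝟘Γ → Σ (Γ M) λ 𝟙Γ →
      (∀ a b → proj₁ (a ⊕ b) ≡ (proj₁ a + proj₁ b) ∧ 𝟙) ×
      (∀ a b → proj₁ (a ⊙ b) ≡ (proj₁ a + proj₁ b + -𝟙) ∨ 𝟘) ×
      (∀ a b → proj₁ (a ∨Γ b) ≡ proj₁ a ∨ proj₁ b) ×
      (∀ a b → proj₁ (a ∧Γ b) ≡ proj₁ a ∧ proj₁ b) ×
      proj₁ 𝟘Γ ≡ 𝟘 × proj₁ 𝟙Γ ≡ 𝟙 ×
      IsMVMonoidal (_≈Γ_ M) _⊕_ _⊙_ _∨Γ_ _∧Γ_ 𝟘Γ 𝟙Γ
proposition3p6 M =
  _⊕Γ_ , _⊙Γ_ , _∨Γ_ , _∧Γ_ , 𝟘Γ , 𝟙Γ ,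
  (λ _ _ → refl) , (λ _ _ → refl) , (λ _ _ → refl) , (λ _ _ → refl) , refl , refl ,
  Γ-isMVMonoidal
  where open ΓConstruction M
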